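{- Let $d$ be a positive integer, let $C$ be a simple cycle of odd length and $f_E$ an e-labeling of its edges with values in $\mathbb{Z}_d$ such that $(C,f_E)$ is compatible. Then $(C,f_E)$ is additive. Moreover, if $d$ is odd then $(C,f_E)$ has exactly one valid v-labeling, and if $d$ is even then it has exactly two valid v-labelings.
   Context: $\mathbb{Z}_d$ denotes the integers modulo $d$. A simple cycle is a cycle graph with distinct vertices. A v-labeling $f_V$ is valid for $(C,f_E)$ if $f_E((v,v'))\equiv f_V(v)+f_V(v')\pmod d$ for every edge $(v,v')$; $(C,f_E)$ is additive if a valid v-labeling exists. Cycles (closed walks, not necessarily simple) of length $k$ have edges $e_1,\dots,e_k$, $e_i=(v_i,v_{i+1})$ for $i<k$, $e_k=(v_k,v_1)$. Even cycle property: every closed walk of even length with edges $e_1,\dots,e_{2k}$ satisfies $\sum_{l\text{ odd}}f_E(e_l)\equiv\sum_{l\text{ even}}f_E(e_l)\pmod d$. Odd cycle property ($d$ even): every closed walk of odd length with edges $e_1,\dots,e_{2k+1}$ satisfies $\frac d2\sum_l f_E(e_l)\equiv0\pmod d$. Compatible: $d$ odd and the even cycle property holds, or $d$ even and both properties hold. -}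

module Defs where

open import Data.Nat using (ℕ; zero; suc; _+_; _*_; _/_; _%_; NonZero)
open import Data.Nat.DivMod using (_mod_)
open import Data.Fin using (Fin; toℕ)
open import Data.List using (List; map; allFin)
open import Data.Nat.ListAction using (sum)
open import Data.Product using (Σ; ∃; _×_; _,_)
open import Data.Sum using (_⊎_)
open import Data.Bool using (if_then_else_)
open import Relation.Nullary using (¬_; does)
open import Relation.Binary.PropositionalEquality using (_≡_; _≢_)
import Data.Nat as N

infix 4 _≡[mod_]_

_≡[mod_]_ : ℕ → (d : ℕ) .{{_ : NonZero d}} → ℕ → Set
a ≡[mod d ] b = a % d ≡ b % d

next : ∀ {k} .{{_ : NonZero k}} → Fin k → Fin k
next {k} i = (toℕ i + 1) mod k

-- The simple cycle C_n: vertices Fin n, edges e_i = (i, i+1 mod n), i : Fin n.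
-- An e-labeling is a function  fE : Fin n → Fin d  (fE i is the label of e_i).
-- Edge n u v : a (directed traversal of an) edge of C_n from u to v.
data Edge (n : ℕ) .{{_ : NonZero n}} : Fin n → Fin n → Set where
  fwd : (i : Fin n) → Edge n i (next i)
  bwd : (i : Fin n) → Edge n (next i) i

edgeIdx : ∀ {n} .{{_ : NonZero n}} {u v : Fin n} → Edge n u v → Fin n
edgeIdx (fwd i) = i
edgeIdx (bwd i) = i

-- A closed walk of length k in C_n: vertices v_1..v_k and edges e_j = (v_j, v_{j+1}),
-- e_k = (v_k, v_1)  (0-indexed here).
record ClosedWalk (n : ℕ) .{{_ : NonZero n}} (k : ℕ) .{{_ : NonZero k}} : Set where
  field
    vtx  : Fin k → Fin n
    edge : (j : Fin k) → Edge n (vtx j) (vtx (next j))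
open ClosedWalk public

walkLabel : ∀ {n d k} .{{_ : NonZero n}} .{{_ : NonZero k}} →
            (Fin n → Fin d) → ClosedWalk n k → Fin k → ℕ
walkLabel fE W j = toℕ (fE (edgeIdx (edge W j)))

sumFin : (k : ℕ) → (Fin k → ℕ) → ℕ
sumFin k g = sum (map g (allFin k))

-- sum over 1-indexed odd positions (= 0-indexed even positions)
sumOddPos : (k : ℕ) → (Fin k → ℕ) → ℕ
sumOddPos k g = sumFin k (λ j → if does (toℕ j % 2 N.≟ 0) then g j else 0)

-- sum over 1-indexed even positions (= 0-indexed odd positions)
sumEvenPos : (k : ℕ) → (Fin k → ℕ) → ℕ
sumEvenPos k g = sumFin k (λ j → if does (toℕ j % 2 N.≟ 0) then 0 else g j)

EvenCycleProperty : (n d : ℕ) .{{_ : NonZero n}} .{{_ : NonZero d}} → (Fin n → Fin d) → Set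
EvenCycleProperty n d fE =
  (k : ℕ) (W : ClosedWalk n (2 * suc k)) →
  sumOddPos (2 * suc k) (walkLabel fE W) ≡[mod d ] sumEvenPos (2 * suc k) (walkLabel fE W)

OddCycleProperty : (n d : ℕ) .{{_ : NonZero n}} .{{_ : NonZero d}} → (Fin n → Fin d) → Set
OddCycleProperty n d fE =
  (k : ℕ) (W : ClosedWalk n (suc (2 * k))) →
  (d / 2) * sumFin (suc (2 * k)) (walkLabel fE W) ≡[mod d ] 0

Compatible : (n d : ℕ) .{{_ : NonZero n}} .{{_ : NonZero d}} → (Fin n → Fin d) → Set
Compatible n d fE =
  (d % 2 ≡ 1 × EvenCycleProperty n d fE) ⊎
  (d % 2 ≡ 0 × EvenCycleProperty n d fE × OddCycleProperty n d fE)

Valid : (n d : ℕ) .{{_ : NonZero n}} .{{_ : NonZero d}} →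
        (Fin n → Fin d) → (Fin n → Fin d) → Set
Valid n d fE fV = (i : Fin n) →
  toℕ (fE i) ≡[mod d ] (toℕ (fV i) + toℕ (fV (next i)))

Additive : (n d : ℕ) .{{_ : NonZero n}} .{{_ : NonZero d}} → (Fin n → Fin d) → Set
Additive n d fE = ∃ λ fV → Valid n d fE fV

ExactlyOneValid : (n d : ℕ) .{{_ : NonZero n}} .{{_ : NonZero d}} → (Fin n → Fin d) → Set
ExactlyOneValid n d fE =
  Σ (Fin n → Fin d) λ g → Valid n d fE g ×
    ((h : Fin n → Fin d) → Valid n d fE h → (i : Fin n) → h i ≡ g i)

ExactlyTwoValid : (n d : ℕ) .{{_ : NonZero n}} .{{_ : NonZero d}} → (Fin n → Fin d) → Set
ExactlyTwoValid n d fE =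
  Σ (Fin n → Fin d) λ g₁ → Σ (Fin n → Fin d) λ g₂ →
    Valid n d fE g₁ × Valid n d fE g₂ × (∃ λ i → g₁ i ≢ g₂ i) ×
    ((h : Fin n → Fin d) → Valid n d fE h →
       ((i : Fin n) → h i ≡ g₁ i) ⊎ ((i : Fin n) → h i ≡ g₂ i))

module Submission where

-- A v-labelling is valid iff f(v_(t+1)) ≡ e_t - f(v_t) for every t.  Hence it is
-- determined by its value x at vertex 0: going once around the cycle forces the
-- values propagate x t, and for odd n one gets propagate x n = A - x, where A is
-- the alternating sum of the labels.  So the valid v-labellings correspond exactly
-- to the classes x modulo d with x + x ≡ A (mod d).
--  * d odd: 2 is invertible modulo d, so there is exactly one such x.
--  * d even, d = 2E: the odd cycle property for the walk once around the cycle
--    says E·(e_0 + … + e_(n-1)) ≡ 0 (mod 2E), so the label sum is even; A has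
--    the parity of the label sum, so A = a + a and the solutions are exactly the
--    two distinct classes a and a + E.

open import Data.Empty using (⊥; ⊥-elim)
open import Data.Fin as Fin using (Fin; toℕ; fromℕ<)
open import Data.Fin.Properties using (toℕ-fromℕ<; toℕ-injective; toℕ<n)
open import Data.Integer using (ℤ; +_; _+_; _*_; -_; _-_; 0ℤ; 1ℤ; -1ℤ; ∣_∣; _⊖_)
open import Data.Integer.Divisibility.Signed using (_∣_; divides; ∣m∣n⇒∣m+n; ∣m⇒∣-m; ∣n⇒∣m*n; ∣⇒∣ᵤ)
open import Data.Integer.DivMod using (_%ℕ_; _/ℕ_; a≡a%ℕn+[a/ℕn]*n; n%ℕd<d)
open import Data.Integer.Properties
  using (neg-involutive; *-cancelʳ-≡; *-cancelˡ-≡; pos-+; pos-*; +-injective; i-j≡0⇒i≡j; m-n≡m⊖n; ∣i∣≡0⇒i≡0; ∣m⊝n∣≤m⊔n)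
open import Data.Integer.Tactic.RingSolver using (solve-∀)
open import Data.List using (_∷_; _++_; [_]; map; tabulate; applyUpTo; allFin)
open import Data.List.Properties using (applyUpTo-∷ʳ; map-tabulate; tabulate-cong)
open import Data.Nat as ℕ using (ℕ; zero; suc; NonZero; _%_; _≤_)
open import Data.Nat.DivMod using (_mod_; m≡m%n+[m/n]*n; m%n<n; m<n⇒m%n≡m; n%n≡0; m%n%n≡m%n; %-distribˡ-+)
open import Data.Nat.Divisibility using (>⇒∤) renaming (_∣_ to _ℕ∣_)
open import Data.Nat.ListAction using (sum)
open import Data.Nat.ListAction.Properties using (sum-++)
import Data.Nat.Properties as ℕ
open import Data.Product using (Σ; _,_; _×_; proj₁; proj₂)
open import Data.Sum as Sum using (_⊎_; inj₁; inj₂)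
open import Function using (id; _∘_)
open import Level using (0ℓ)
open import Relation.Binary.Bundles using (Setoid)
import Relation.Binary.Reasoning.Setoid as SetoidReasoning
open import Relation.Binary.PropositionalEquality using (_≡_; refl; subst; trans; cong; sym; module ≡-Reasoning)
open import Relation.Nullary using (¬_; contradiction)

open import Defs
  using (_≡[mod_]_; next; fwd; ClosedWalk; Valid; Additive; Compatible; ExactlyOneValid; ExactlyTwoValid; sumFin)

infix 4 _≈_[mod_]

-- Congruence of integers modulo m: m divides the difference.  (A record rather
-- than a definition so that a and b can be inferred from the type.)
record _≈_[mod_] (a b : ℤ) (m : ℕ) : Set where
  constructor congruent
  field divides-difference : + m ∣ a - b

open _≈_[mod_]

module _ {m : ℕ} where

  -- every congruence is obtained by rewriting a divisibility along a ring identity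
  private
    divides-≡ : ∀ {a b x} → x ≡ a - b → + m ∣ x → a ≈ b [mod m ]
    divides-≡ eq p = congruent (subst (+ m ∣_) eq p)

  ≈-reflexive : ∀ {a b} → a ≡ b → a ≈ b [mod m ]
  ≈-reflexive {a} refl = congruent (divides 0ℤ (ring a (+ m)))
    where ring : ∀ a m → a - a ≡ 0ℤ * m
          ring = solve-∀

  ≈-sym : ∀ {a b} → a ≈ b [mod m ] → b ≈ a [mod m ]
  ≈-sym {a} {b} p = divides-≡ (ring a b) (∣m⇒∣-m (divides-difference p))
    where ring : ∀ a b → - (a - b) ≡ b - a
          ring = solve-∀

  ≈-trans : ∀ {a b c} → a ≈ b [mod m ] → b ≈ c [mod m ] → a ≈ c [mod m ]
  ≈-trans {a} {b} {c} p q = divides-≡ (ring a b c) (∣m∣n⇒∣m+n (divides-difference p) (divides-difference q))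
    where ring : ∀ a b c → (a - b) + (b - c) ≡ a - c
          ring = solve-∀

  +-cong : ∀ {a b c e} → a ≈ b [mod m ] → c ≈ e [mod m ] → a + c ≈ b + e [mod m ]
  +-cong {a} {b} {c} {e} p q = divides-≡ (ring a b c e) (∣m∣n⇒∣m+n (divides-difference p) (divides-difference q))
    where ring : ∀ a b c e → (a - b) + (c - e) ≡ (a + c) - (b + e)
          ring = solve-∀

  -‿congʳ : ∀ c {a b} → a ≈ b [mod m ] → c - a ≈ c - b [mod m ]
  -‿congʳ c {a} {b} p = divides-≡ (ring a b c) (∣m⇒∣-m (divides-difference p))
    where ring : ∀ a b c → - (a - b) ≡ (c - a) - (c - b)
          ring = solve-∀

  *-congˡ : ∀ c {a b} → a ≈ b [mod m ] → c * a ≈ c * b [mod m ]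
  *-congˡ c {a} {b} p = divides-≡ (ring a b c) (∣n⇒∣m*n c (divides-difference p))
    where ring : ∀ a b c → c * (a - b) ≡ c * a - c * b
          ring = solve-∀

  ≈-solveʳ : ∀ {a b c} → c ≈ a + b [mod m ] → b ≈ c - a [mod m ]
  ≈-solveʳ {a} {b} {c} p = divides-≡ (ring a b c) (∣m⇒∣-m (divides-difference p))
    where ring : ∀ a b c → - (c - (a + b)) ≡ b - (c - a)
          ring = solve-∀

  ≈-quotient : ∀ {x r} q → x ≡ r + q * + m → x ≈ r [mod m ]
  ≈-quotient {x} {r} q eq = congruent (divides q (trans (cong (_- r) eq) (ring r q (+ m))))
    where ring : ∀ r q m → (r + q * m) - r ≡ q * m
          ring = solve-∀

  quotient-of : ∀ {x r} → x ≈ r [mod m ] → Σ ℤ λ q → x ≡ r + q * + m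
  quotient-of {x} {r} (congruent (divides q eq)) = q , trans (ring x r) (cong (λ t → r + t) eq)
    where ring : ∀ x r → x ≡ r + (x - r)
          ring = solve-∀

≈-setoid : ℕ → Setoid 0ℓ 0ℓ
≈-setoid m = record
  { Carrier       = ℤ
  ; _≈_           = _≈_[mod m ]
  ; isEquivalence = record { refl = ≈-reflexive refl ; sym = ≈-sym ; trans = ≈-trans }
  }

module ≈-Reasoning (m : ℕ) = SetoidReasoning (≈-setoid m)

module _ (d : ℕ) .{{_ : NonZero d}} where

  ≈-% : ∀ a → + a ≈ + (a % d) [mod d ]
  ≈-% a = ≈-quotient (+ (a ℕ./ d)) (begin
    + a                                   ≡⟨ cong +_ (m≡m%n+[m/n]*n a d) ⟩
    + (a % d ℕ.+ a ℕ./ d ℕ.* d)         ≡⟨ pos-+ (a % d) (a ℕ./ d ℕ.* d) ⟩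
    + (a % d) + + (a ℕ./ d ℕ.* d)       ≡⟨ cong (λ t → + (a % d) + t) (pos-* (a ℕ./ d) d) ⟩
    + (a % d) + + (a ℕ./ d) * + d       ∎)
    where open ≡-Reasoning

  ≈-%ℕ : ∀ z → z ≈ + (z %ℕ d) [mod d ]
  ≈-%ℕ z = ≈-quotient (z /ℕ d) (a≡a%ℕn+[a/ℕn]*n z d)

  residue-unique : ∀ {r s} → r ℕ.< d → s ℕ.< d → + r ≈ + s [mod d ] → r ≡ s
  residue-unique {r} {s} r<d s<d r≈s with ∣ r ⊖ s ∣ in dist
  ... | zero  = +-injective (i-j≡0⇒i≡j (+ r) (+ s) (trans (m-n≡m⊖n r s) (∣i∣≡0⇒i≡0 dist)))
  ... | suc δ = contradiction d∣dist (>⇒∤ dist<d)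
    where
      d∣dist : d ℕ∣ suc δ
      d∣dist = subst (d ℕ∣_) (trans (cong ∣_∣ (m-n≡m⊖n r s)) dist) (∣⇒∣ᵤ (divides-difference r≈s))
      dist<d : suc δ ℕ.< d
      dist<d = subst (ℕ._< d) dist (ℕ.≤-<-trans (∣m⊝n∣≤m⊔n r s) (ℕ.⊔-pres-<m r<d s<d))

  ≡[mod]⇒≈ : ∀ {a b} → a ≡[mod d ] b → + a ≈ + b [mod d ]
  ≡[mod]⇒≈ {a} {b} eq = ≈-trans (≈-% a) (≈-trans (≈-reflexive (cong +_ eq)) (≈-sym (≈-% b)))

  ≈⇒≡[mod] : ∀ {a b} → + a ≈ + b [mod d ] → a ≡[mod d ] b
  ≈⇒≡[mod] {a} {b} a≈b = residue-unique (m%n<n a d) (m%n<n b d)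
    (≈-trans (≈-sym (≈-% a)) (≈-trans a≈b (≈-% b)))

  reduce : ℤ → Fin d
  reduce z = fromℕ< (n%ℕd<d z d)

  reduce-≈ : ∀ z → + toℕ (reduce z) ≈ z [mod d ]
  reduce-≈ z = ≈-sym (subst (λ r → z ≈ + r [mod d ]) (sym (toℕ-fromℕ< (n%ℕd<d z d))) (≈-%ℕ z))

  reduce-unique : ∀ (r : Fin d) {z} → + toℕ r ≈ z [mod d ] → r ≡ reduce z
  reduce-unique r {z} r≈z = toℕ-injective
    (residue-unique (toℕ<n r) (toℕ<n (reduce z)) (≈-trans r≈z (≈-sym (reduce-≈ z))))

  reduce-cong : ∀ {a b} → a ≈ b [mod d ] → reduce a ≡ reduce b
  reduce-cong {a} a≈b = reduce-unique (reduce a) (≈-trans (reduce-≈ a) a≈b)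

  reduce-injective : ∀ {a b} → reduce a ≡ reduce b → a ≈ b [mod d ]
  reduce-injective {a} {b} eq =
    ≈-trans (≈-sym (reduce-≈ a)) (≈-trans (≈-reflexive (cong (λ r → + toℕ r) eq)) (reduce-≈ b))

-- Modulo an odd d = 2k+1 the congruence x + x ≡ a has exactly one solution,
-- since k+1 is an inverse of 2.
module _ {d : ℕ} (k : ℕ) (d-odd : d ≡ suc (k ℕ.* 2)) where

  private
    half : ℤ → ℤ
    half a = (1ℤ + + k) * a

    half-double : ∀ y → half (y + y) ≈ y [mod d ]
    half-double y rewrite d-odd = ≈-quotient y (begin
      (1ℤ + + k) * (y + y)           ≡⟨ ring (+ k) y ⟩
      y + y * (1ℤ + + k * + 2)       ≡⟨ cong (λ t → y + y * (1ℤ + t)) (pos-* k 2) ⟨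
      y + y * (1ℤ + + (k ℕ.* 2))     ≡⟨ cong (λ t → y + y * t) (pos-+ 1 (k ℕ.* 2)) ⟨
      y + y * + suc (k ℕ.* 2)        ∎)
      where
        open ≡-Reasoning
        ring : ∀ k y → (1ℤ + k) * (y + y) ≡ y + y * (1ℤ + k * + 2)
        ring = solve-∀

  odd-half : ∀ a → Σ ℤ λ x → x + x ≈ a [mod d ]
  odd-half a = half a , ≈-trans (≈-reflexive (ring (1ℤ + + k) a)) (half-double a)
    where ring : ∀ c a → c * a + c * a ≡ c * (a + a)
          ring = solve-∀

  odd-half-unique : ∀ {x y a} → x + x ≈ a [mod d ] → y + y ≈ a [mod d ] → x ≈ y [mod d ]
  odd-half-unique {x} {y} 2x≈a 2y≈a = begin
    x                ≈⟨ half-double x ⟨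
    half (x + x)     ≈⟨ *-congˡ (1ℤ + + k) (≈-trans 2x≈a (≈-sym 2y≈a)) ⟩
    half (y + y)     ≈⟨ half-double y ⟩
    y                ∎
    where open ≈-Reasoning d

module _ {d : ℕ} (E : ℕ) (d-even : d ≡ E ℕ.* 2) where

  private
    even-cast : + d ≡ + E * + 2
    even-cast = trans (cong +_ d-even) (pos-* E 2)

    halve : ∀ {x y} → x + x ≈ y + y [mod d ] → x ≈ y [mod E ]
    halve {x} {y} 2x≈2y with quotient-of 2x≈2y
    ... | q , eq = ≈-quotient q (*-cancelʳ-≡ x (y + q * + E) (+ 2) (begin
      x * + 2                 ≡⟨ ring₁ x ⟩
      x + x                   ≡⟨ eq ⟩
      y + y + q * + d         ≡⟨ cong (λ m → y + y + q * m) even-cast ⟩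
      y + y + q * (+ E * + 2) ≡⟨ ring₂ y q (+ E) ⟩
      (y + q * + E) * + 2     ∎))
      where
        open ≡-Reasoning
        ring₁ : ∀ x → x * + 2 ≡ x + x
        ring₁ = solve-∀
        ring₂ : ∀ y q e → y + y + q * (e * + 2) ≡ (y + q * e) * + 2
        ring₂ = solve-∀

    -- a class modulo E splits into two classes modulo 2E, by the parity of the quotient
    split : ∀ {x y} → x ≈ y [mod E ] → x ≈ y [mod d ] ⊎ x ≈ y + + E [mod d ]
    split {x} {y} x≈y = by-parity (q %ℕ 2) (n%ℕd<d q 2) (≈-quotient (q /ℕ 2) (begin
      x                                         ≡⟨ eq ⟩
      y + q * + E                               ≡⟨ cong (λ q → y + q * + E) (a≡a%ℕn+[a/ℕn]*n q 2) ⟩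
      y + (+ (q %ℕ 2) + q /ℕ 2 * + 2) * + E     ≡⟨ ring y (+ (q %ℕ 2)) (q /ℕ 2) (+ E) ⟩
      y + + (q %ℕ 2) * + E + q /ℕ 2 * (+ E * + 2) ≡⟨ cong (λ m → y + + (q %ℕ 2) * + E + q /ℕ 2 * m) even-cast ⟨
      y + + (q %ℕ 2) * + E + q /ℕ 2 * + d       ∎))
      where
        open ≡-Reasoning
        q : ℤ
        q = proj₁ (quotient-of x≈y)
        eq : x ≡ y + q * + E
        eq = proj₂ (quotient-of x≈y)
        ring : ∀ y r h e → y + (r + h * + 2) * e ≡ y + r * e + h * (e * + 2)
        ring = solve-∀
        by-parity : ∀ r → r ℕ.< 2 → x ≈ y + + r * + E [mod d ] → x ≈ y [mod d ] ⊎ x ≈ y + + E [mod d ]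
        by-parity 0 _ x≈y+0 = inj₁ (≈-trans x≈y+0 (≈-reflexive (ring₀ y (+ E))))
          where ring₀ : ∀ y e → y + + 0 * e ≡ y
                ring₀ = solve-∀
        by-parity 1 _ x≈y+E = inj₂ (≈-trans x≈y+E (≈-reflexive (ring₁ y (+ E))))
          where ring₁ : ∀ y e → y + + 1 * e ≡ y + e
                ring₁ = solve-∀
        by-parity (suc (suc _)) (ℕ.s≤s (ℕ.s≤s ())) _

  even-halves : ∀ {x a} → x + x ≈ a + a [mod d ] → x ≈ a [mod d ] ⊎ x ≈ a + + E [mod d ]
  even-halves 2x≈2a = split (halve 2x≈2a)

  even-other-half : ∀ a → (a + + E) + (a + + E) ≈ a + a [mod d ]
  even-other-half a = ≈-quotient 1ℤ (trans (ring a (+ E)) (cong (λ m → a + a + 1ℤ * m) (sym even-cast)))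
    where ring : ∀ a e → (a + e) + (a + e) ≡ a + a + 1ℤ * (e * + 2)
          ring = solve-∀

  even-halves-distinct : .{{_ : NonZero d}} .{{_ : NonZero E}} → ∀ a → ¬ a ≈ a + + E [mod d ]
  even-halves-distinct a a≈a+E = ℕ.≢-nonZero⁻¹ E (residue-unique d E<d 0<d (begin
    + E                       ≡⟨ ring a (+ E) ⟩
    (a + + E) - a             ≈⟨ -‿congʳ (a + + E) a≈a+E ⟩
    (a + + E) - (a + + E)     ≡⟨ ring′ (a + + E) ⟩
    + 0                       ∎))
    where
      open ≈-Reasoning d
      E<d : E ℕ.< d
      E<d = subst (E ℕ.<_) (sym d-even) (ℕ.m<m*n E 2 (ℕ.s≤s (ℕ.s≤s ℕ.z≤n)))
      0<d : 0 ℕ.< d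
      0<d = ℕ.>-nonZero⁻¹ d
      ring : ∀ a e → e ≡ (a + e) - a
      ring = solve-∀
      ring′ : ∀ b → b - b ≡ + 0
      ring′ = solve-∀

  even-multiple : .{{_ : NonZero E}} → ∀ S → + (E ℕ.* S) ≈ 0ℤ [mod d ] → + S ≈ 0ℤ [mod 2 ]
  even-multiple S ES≈0 with quotient-of ES≈0
  ... | q , eq = ≈-quotient q (*-cancelˡ-≡ (+ E) (+ S) (0ℤ + q * + 2) (begin
    + E * + S                 ≡⟨ pos-* E S ⟨
    + (E ℕ.* S)               ≡⟨ eq ⟩
    0ℤ + q * + d              ≡⟨ cong (λ m → 0ℤ + q * m) even-cast ⟩
    0ℤ + q * (+ E * + 2)      ≡⟨ ring (+ E) q ⟩
    + E * (0ℤ + q * + 2)      ∎))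
    where
      open ≡-Reasoning
      ring : ∀ e q → 0ℤ + q * (e * + 2) ≡ e * (0ℤ + q * + 2)
      ring = solve-∀

tabulate-applyUpTo : ∀ {A : Set} {m} (f : ℕ → A) → tabulate {n = m} (f ∘ toℕ) ≡ applyUpTo f m
tabulate-applyUpTo {m = zero}  f = refl
tabulate-applyUpTo {m = suc m} f = cong (f 0 ∷_) (tabulate-applyUpTo (f ∘ suc))

alt : ℕ → ℤ
alt zero    = 1ℤ
alt (suc t) = - alt t

alt-odd : ∀ k → alt (suc (2 ℕ.* k)) ≡ -1ℤ
alt-odd zero    = refl
alt-odd (suc k) = begin
  alt (suc (2 ℕ.* suc k))       ≡⟨ cong (λ t → alt (suc t)) (ℕ.*-suc 2 k) ⟩
  - - alt (suc (2 ℕ.* k))       ≡⟨ neg-involutive _ ⟩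
  alt (suc (2 ℕ.* k))           ≡⟨ alt-odd k ⟩
  -1ℤ                           ∎
  where open ≡-Reasoning

module Cycle (d : ℕ) .{{_ : NonZero d}} (p : ℕ) (fE : Fin (suc p) → Fin d) where

  n : ℕ
  n = suc p

  -- Vertex t of the infinite walk 0, 1, 2, … around the cycle is t mod n.
  mod-toℕ : ∀ (j : Fin n) → toℕ j mod n ≡ j
  mod-toℕ j = toℕ-injective (trans (toℕ-fromℕ< _) (m<n⇒m%n≡m (toℕ<n j)))

  toℕ-next : ∀ (j : Fin n) → toℕ (next j) ≡ suc (toℕ j) % n
  toℕ-next j = trans (toℕ-fromℕ< _) (cong (_% n) (ℕ.+-comm (toℕ j) 1))

  next-mod : ∀ t → next (t mod n) ≡ suc t mod n
  next-mod t = toℕ-injective (begin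
    toℕ (next (t mod n))        ≡⟨ toℕ-next (t mod n) ⟩
    suc (toℕ (t mod n)) % n     ≡⟨ cong (λ r → suc r % n) (toℕ-fromℕ< _) ⟩
    (1 ℕ.+ t % n) % n           ≡⟨ %-distribˡ-+ 1 (t % n) n ⟩
    (1 % n ℕ.+ t % n % n) % n   ≡⟨ cong (λ r → (1 % n ℕ.+ r) % n) (m%n%n≡m%n t n) ⟩
    (1 % n ℕ.+ t % n) % n       ≡⟨ %-distribˡ-+ 1 t n ⟨
    suc t % n                   ≡⟨ toℕ-fromℕ< _ ⟨
    toℕ (suc t mod n)           ∎)
    where open ≡-Reasoning

  mod-period : n mod n ≡ 0 mod n
  mod-period = toℕ-injective (trans (toℕ-fromℕ< _) (trans (n%n≡0 n) (sym (toℕ-fromℕ< (m%n<n 0 n)))))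

  label : ℕ → ℕ
  label t = toℕ (fE (t mod n))

  -- The values forced along the walk by the edge equations f(v_t) + f(v_(t+1)) = e_t,
  -- starting from the value x at vertex 0.
  propagate : ℤ → ℕ → ℤ
  propagate x zero    = x
  propagate x (suc t) = + label t - propagate x t

  propagate-cong : ∀ {x y} → x ≈ y [mod d ] → ∀ t → propagate x t ≈ propagate y t [mod d ]
  propagate-cong x≈y zero    = x≈y
  propagate-cong x≈y (suc t) = -‿congʳ (+ label t) (propagate-cong x≈y t)

  labelling : ℤ → Fin n → Fin d
  labelling x j = reduce d (propagate x (toℕ j))

  labelling-cong : ∀ {x y} → x ≈ y [mod d ] → ∀ j → labelling x j ≡ labelling y j
  labelling-cong x≈y j = reduce-cong d (propagate-cong x≈y (toℕ j))

  Closes : ℤ → Set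
  Closes x = propagate x n ≈ x [mod d ]

  propagate-wraps : ∀ {x} → Closes x → ∀ t → t ℕ.< n →
                    propagate x (suc t) ≈ propagate x (suc t % n) [mod d ]
  propagate-wraps {x} closes t t<n with ℕ.m≤n⇒m<n∨m≡n t<n
  ... | inj₁ t+1<n = ≈-reflexive (cong (propagate x) (sym (m<n⇒m%n≡m t+1<n)))
  ... | inj₂ refl  = ≈-trans closes (≈-reflexive (cong (propagate x) (sym (n%n≡0 n))))

  closes⇒valid : ∀ {x} → Closes x → Valid n d fE (labelling x)
  closes⇒valid {x} closes j = ≈⇒≡[mod] d (begin
    + toℕ (fE j)                                   ≡⟨ cong (λ i → + toℕ (fE i)) (mod-toℕ j) ⟨
    + label t                                      ≡⟨ ring (+ label t) (propagate x t) ⟩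
    propagate x t + propagate x (suc t)            ≈⟨ +-cong (≈-reflexive {a = propagate x t} refl) (propagate-wraps closes t (toℕ<n j)) ⟩
    propagate x t + propagate x (suc t % n)        ≡⟨ cong (λ s → propagate x t + propagate x s) (toℕ-next j) ⟨
    propagate x t + propagate x (toℕ (next j))     ≈⟨ +-cong (reduce-≈ d (propagate x t)) (reduce-≈ d (propagate x (toℕ (next j)))) ⟨
    + toℕ (labelling x j) + + toℕ (labelling x (next j))
                                                   ≡⟨ pos-+ (toℕ (labelling x j)) _ ⟨
    + (toℕ (labelling x j) ℕ.+ toℕ (labelling x (next j))) ∎)
    where
      open ≈-Reasoning d
      t : ℕ
      t = toℕ j
      ring : ∀ e q → e ≡ q + (e - q)
      ring = solve-∀

  module ValidLabelling (h : Fin n → Fin d) (valid : Valid n d fE h) where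

    around : ℕ → ℤ
    around t = + toℕ (h (t mod n))

    step : ∀ t → around (suc t) ≈ + label t - around t [mod d ]
    step t = ≈-solveʳ {a = around t} (begin
      + label t                                    ≈⟨ ≡[mod]⇒≈ d (valid (t mod n)) ⟩
      + (toℕ (h (t mod n)) ℕ.+ toℕ (h (next (t mod n))))
                                                   ≡⟨ pos-+ (toℕ (h (t mod n))) _ ⟩
      around t + + toℕ (h (next (t mod n)))        ≡⟨ cong (λ i → around t + + toℕ (h i)) (next-mod t) ⟩
      around t + around (suc t)                    ∎)
      where open ≈-Reasoning d

    follows : ∀ t → around t ≈ propagate (around 0) t [mod d ]
    follows zero    = ≈-reflexive refl
    follows (suc t) = ≈-trans (step t) (-‿congʳ (+ label t) (follows t))

    closes : Closes (around 0)
    closes = ≈-trans (≈-sym (follows n)) (≈-reflexive (cong (λ i → + toℕ (h i)) mod-period))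

    determined : ∀ j → h j ≡ labelling (around 0) j
    determined j = reduce-unique d (h j)
      (≈-trans (≈-reflexive (cong (λ i → + toℕ (h i)) (sym (mod-toℕ j)))) (follows (toℕ j)))

  propagate-affine : ∀ x t → propagate x t ≡ propagate 0ℤ t + alt t * x
  propagate-affine x zero    = ring x
    where ring : ∀ x → x ≡ 0ℤ + 1ℤ * x
          ring = solve-∀
  propagate-affine x (suc t) = begin
    + label t - propagate x t                   ≡⟨ cong (λ q → + label t - q) (propagate-affine x t) ⟩
    + label t - (propagate 0ℤ t + alt t * x)    ≡⟨ ring (+ label t) (propagate 0ℤ t) (alt t) x ⟩
    (+ label t - propagate 0ℤ t) + - alt t * x  ∎
    where
      open ≡-Reasoning
      ring : ∀ e q s x → e - (q + s * x) ≡ (e - q) + - s * x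
      ring = solve-∀

  -- the alternating sum e_(n-1) - e_(n-2) + … ± e_0 of the edge labels
  A : ℤ
  A = propagate 0ℤ n

  module OddLength (n-odd : alt n ≡ -1ℤ) where

    propagate-around : ∀ x → propagate x n ≡ A - x
    propagate-around x = trans (propagate-affine x n) (trans (cong (λ s → A + s * x) n-odd) (ring A x))
      where ring : ∀ a x → a + -1ℤ * x ≡ a - x
            ring = solve-∀

    solution⇒valid : ∀ {x} → x + x ≈ A [mod d ] → Valid n d fE (labelling x)
    solution⇒valid {x} 2x≈A = closes⇒valid (begin
      propagate x n       ≡⟨ propagate-around x ⟩
      A - x               ≈⟨ +-cong 2x≈A (≈-reflexive {a = - x} refl) ⟨
      (x + x) - x         ≡⟨ ring x ⟩
      x                   ∎)
      where
        open ≈-Reasoning d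
        ring : ∀ x → (x + x) - x ≡ x
        ring = solve-∀

    valid⇒solution : ∀ {h} → Valid n d fE h →
                     Σ ℤ λ x → x + x ≈ A [mod d ] × (∀ j → h j ≡ labelling x j)
    valid⇒solution {h} valid = x , 2x≈A , determined
      where
        open ValidLabelling h valid
        x : ℤ
        x = around 0
        2x≈A : x + x ≈ A [mod d ]
        2x≈A = begin
          x + x               ≈⟨ +-cong closes (≈-reflexive {a = x} refl) ⟨
          propagate x n + x   ≡⟨ cong (_+ x) (propagate-around x) ⟩
          A - x + x           ≡⟨ ring A x ⟩
          A                   ∎
          where
            open ≈-Reasoning d
            ring : ∀ a x → a - x + x ≡ a
            ring = solve-∀

    exactly-one : ∀ k → d ≡ suc (k ℕ.* 2) → ExactlyOneValid n d fE
    exactly-one k d-odd = labelling x₀ , solution⇒valid 2x₀≈A , unique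
      where
        x₀ : ℤ
        x₀ = proj₁ (odd-half k d-odd A)
        2x₀≈A : x₀ + x₀ ≈ A [mod d ]
        2x₀≈A = proj₂ (odd-half k d-odd A)
        unique : ∀ h → Valid n d fE h → ∀ j → h j ≡ labelling x₀ j
        unique h valid j =
          let x , 2x≈A , h≡ = valid⇒solution {h} valid
          in trans (h≡ j) (labelling-cong (odd-half-unique k d-odd 2x≈A 2x₀≈A) j)

    exactly-two : ∀ E .{{_ : NonZero E}} → d ≡ E ℕ.* 2 → A ≈ 0ℤ [mod 2 ] → ExactlyTwoValid n d fE
    exactly-two E d-even A-even =
      labelling a , labelling (a + + E) ,
      solution⇒valid 2a≈A , solution⇒valid (≈-trans (even-other-half E d-even a) 2a≈A) ,
      (Fin.zero , λ eq → even-halves-distinct E d-even a (reduce-injective d eq)) ,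
      unique
      where
        a : ℤ
        a = proj₁ (quotient-of A-even)
        2a≈A : a + a ≈ A [mod d ]
        2a≈A = ≈-reflexive (sym (trans (proj₂ (quotient-of A-even)) (ring a)))
          where ring : ∀ a → 0ℤ + a * + 2 ≡ a + a
                ring = solve-∀
        unique : ∀ h → Valid n d fE h →
                 (∀ j → h j ≡ labelling a j) ⊎ (∀ j → h j ≡ labelling (a + + E) j)
        unique h valid =
          let x , 2x≈A , h≡ = valid⇒solution {h} valid
          in Sum.map (λ x≈a j → trans (h≡ j) (labelling-cong x≈a j))
                     (λ x≈a+E j → trans (h≡ j) (labelling-cong x≈a+E j))
                     (even-halves E d-even (≈-trans 2x≈A (≈-sym 2a≈A)))

  labelSum : ℕ → ℕ
  labelSum t = sum (applyUpTo label t)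

  labelSum-suc : ∀ t → labelSum (suc t) ≡ labelSum t ℕ.+ label t
  labelSum-suc t = begin
    sum (applyUpTo label (suc t))            ≡⟨ cong sum (applyUpTo-∷ʳ label t) ⟨
    sum (applyUpTo label t ++ [ label t ])   ≡⟨ sum-++ (applyUpTo label t) [ label t ] ⟩
    labelSum t ℕ.+ (label t ℕ.+ 0)           ≡⟨ cong (labelSum t ℕ.+_) (ℕ.+-identityʳ (label t)) ⟩
    labelSum t ℕ.+ label t                   ∎
    where open ≡-Reasoning

  propagate-parity : ∀ t → propagate 0ℤ t ≈ + labelSum t [mod 2 ]
  propagate-parity zero    = ≈-reflexive refl
  propagate-parity (suc t) = begin
    + label t - propagate 0ℤ t        ≈⟨ -‿congʳ (+ label t) (propagate-parity t) ⟩
    + label t - + labelSum t          ≈⟨ ≈-quotient (- + labelSum t) (ring (+ label t) (+ labelSum t)) ⟩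
    + labelSum t + + label t          ≡⟨ pos-+ (labelSum t) (label t) ⟨
    + (labelSum t ℕ.+ label t)        ≡⟨ cong +_ (labelSum-suc t) ⟨
    + labelSum (suc t)                ∎
    where
      open ≈-Reasoning 2
      ring : ∀ e s → e - s ≡ (s + e) + - s * + 2
      ring = solve-∀

  -- the sum in the odd cycle property, for the walk once around the cycle
  labelSum-cycle : sumFin n (λ j → toℕ (fE j)) ≡ labelSum n
  labelSum-cycle = begin
    sum (map (λ j → toℕ (fE j)) (allFin n))  ≡⟨ cong sum (map-tabulate id (λ j → toℕ (fE j))) ⟩
    sum (tabulate (λ j → toℕ (fE j)))         ≡⟨ cong sum (tabulate-cong {n = n} λ j → cong (λ i → toℕ (fE i)) (sym (mod-toℕ j))) ⟩
    sum (tabulate (λ (j : Fin n) → label (toℕ j))) ≡⟨ cong sum (tabulate-applyUpTo {m = n} label) ⟩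
    labelSum n                                ∎
    where open ≡-Reasoning

odd-form : ∀ m → m % 2 ≡ 1 → m ≡ suc (m ℕ./ 2 ℕ.* 2)
odd-form m m-odd = trans (m≡m%n+[m/n]*n m 2) (cong (ℕ._+ m ℕ./ 2 ℕ.* 2) m-odd)

even-form : ∀ m → m % 2 ≡ 0 → m ≡ m ℕ./ 2 ℕ.* 2
even-form m m-even = trans (m≡m%n+[m/n]*n m 2) (cong (ℕ._+ m ℕ./ 2 ℕ.* 2) m-even)

odd∧even⇒⊥ : ∀ m → m % 2 ≡ 1 → m % 2 ≡ 0 → ⊥
odd∧even⇒⊥ _ m-odd m-even with trans (sym m-odd) m-even
... | ()

half-nonZero : ∀ {d E} .{{_ : NonZero d}} → d ≡ E ℕ.* 2 → NonZero E
half-nonZero {d} {zero}  d≡0 = contradiction d≡0 (ℕ.≢-nonZero⁻¹ d)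
half-nonZero {E = suc _} _   = _

module _ {n d : ℕ} .{{_ : NonZero n}} .{{_ : NonZero d}} {fE : Fin n → Fin d} where

  one⇒additive : ExactlyOneValid n d fE → Additive n d fE
  one⇒additive (g , valid , _) = g , valid

  two⇒additive : ExactlyTwoValid n d fE → Additive n d fE
  two⇒additive (g , _ , valid , _) = g , valid

odd-cycle : ∀ d .{{_ : NonZero d}} n .{{_ : NonZero n}} k → n ≡ suc (2 ℕ.* k) →
            (fE : Fin n → Fin d) → Compatible n d fE →
            Additive n d fE ×
            (d % 2 ≡ 1 → ExactlyOneValid n d fE) ×
            (d % 2 ≡ 0 → ExactlyTwoValid n d fE)
odd-cycle d _ k refl fE (inj₁ (d-odd , _)) =
  one⇒additive one , (λ _ → one) , λ d-even → ⊥-elim (odd∧even⇒⊥ d d-odd d-even)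
  where
    open Cycle d (2 ℕ.* k) fE
    open OddLength (alt-odd k)
    one : ExactlyOneValid n d fE
    one = exactly-one (d ℕ./ 2) (odd-form d d-odd)
odd-cycle d _ k refl fE (inj₂ (d-even , _ , odd-cycle-property)) =
  two⇒additive two , (λ d-odd → ⊥-elim (odd∧even⇒⊥ d d-odd d-even)) , λ _ → two
  where
    open Cycle d (2 ℕ.* k) fE
    open OddLength (alt-odd k)
    E : ℕ
    E = d ℕ./ 2
    d≡2E : d ≡ E ℕ.* 2
    d≡2E = even-form d d-even
    instance
      E-nonZero : NonZero E
      E-nonZero = half-nonZero d≡2E
    -- the odd cycle property for the walk once around C_n makes the label sum even
    once-around : ClosedWalk n n
    once-around = record { vtx = id ; edge = fwd }
    labelSum-even : + labelSum n ≈ 0ℤ [mod 2 ]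
    labelSum-even = subst (λ s → + s ≈ 0ℤ [mod 2 ]) labelSum-cycle
      (even-multiple E d≡2E _ (≡[mod]⇒≈ d (odd-cycle-property k once-around)))
    two : ExactlyTwoValid n d fE
    two = exactly-two E d≡2E (≈-trans (propagate-parity n) labelSum-even)

lemma5 : (d : ℕ) .{{_ : NonZero d}} (n : ℕ) .{{_ : NonZero n}} →
         3 ≤ n → n % 2 ≡ 1 →
         (fE : Fin n → Fin d) → Compatible n d fE →
         Additive n d fE ×
         (d % 2 ≡ 1 → ExactlyOneValid n d fE) ×
         (d % 2 ≡ 0 → ExactlyTwoValid n d fE)
lemma5 d n _ n-odd = odd-cycle d n (n ℕ./ 2) n≡2k+1
  where
    n≡2k+1 : n ≡ suc (2 ℕ.* (n ℕ./ 2))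
    n≡2k+1 = trans (odd-form n n-odd) (cong suc (ℕ.*-comm (n ℕ./ 2) 2))
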